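{- Let $F(\mathbf{X},\mathbf{Y})$ be a Boolean specification with outputs $\mathbf{X}=(x_1,\ldots,x_n)$ and inputs $\mathbf{Y}$, and let $(\mathbf{T},\mathsf{Fun}_{\mathbf{T}})$ be an acyclic system of functional definitions in $F$. (1) If $\mathbf{X}=\mathbf{T}$, then $\mathsf{Fun}_{\mathbf{T}}\preceq_{syn}F$. (2) If $\mathbf{X}\setminus\mathbf{T}\neq\emptyset$, then for every $x_i\in\mathbf{X}\setminus\mathbf{T}$: if $\theta_{F,\mathbf{T},x_i,0}$ is a tautology, then $(x_i\wedge F|_{x_i=1})\preceq_{syn}F$; and if $\theta_{F,\mathbf{T},x_i,1}$ is a tautology, then $(\neg x_i\wedge F|_{x_i=0})\preceq_{syn}F$.
   Context: $\widetilde{F}\preceq_{syn}F$ means: (a) $\forall\mathbf{Y}\,(\exists\mathbf{X}\,F(\mathbf{X},\mathbf{Y})\Rightarrow\exists\mathbf{X}'\,\widetilde{F}(\mathbf{X}',\mathbf{Y}))$, and (b) $\forall\mathbf{Y}\,\forall\mathbf{X}'\,((\exists\mathbf{X}\,F(\mathbf{X},\mathbf{Y})\wedge\widetilde{F}(\mathbf{X}',\mathbf{Y}))\Rightarrow F(\mathbf{X}',\mathbf{Y}))$. An output $x_j$ is functionally determined in $F$ with functional definition (f-def) $x_j\Leftrightarrow g_j$, where $g_j$ is a formula over variables of $\mathbf{X}\cup\mathbf{Y}$ other than $x_j$, if $F\Rightarrow(x_j\Leftrightarrow g_j)$ is valid. For $\mathbf{T}\subseteq\mathbf{X}$ a set of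 such variables, $\mathsf{Fun}_{\mathbf{T}}$ is the conjunction of one f-def for each variable in $\mathbf{T}$; $(\mathbf{T},\mathsf{Fun}_{\mathbf{T}})$ is acyclic if no variable in $\mathbf{T}$ transitively depends on itself via the f-defs in $\mathsf{Fun}_{\mathbf{T}}$. For $x_i\in\mathbf{X}\setminus\mathbf{T}$ and $a\in\{0,1\}$, with $\mathbf{X}'=(x_1',\ldots,x_n')$ fresh variables and $\mathsf{Fun}_{\mathbf{T}}(\mathbf{X}',\mathbf{Y})$ denoting $\mathsf{Fun}_{\mathbf{T}}$ with each $x_j$ renamed $x_j'$, $$\theta_{F,\mathbf{T},x_i,a}:=\Big(F(\mathbf{X},\mathbf{Y})|_{x_i=a}\wedge\bigwedge_{x_j\in\mathbf{X}\setminus(\mathbf{T}\cup\{x_i\})}(x_j\Leftrightarrow x_j')\wedge\mathsf{Fun}_{\mathbf{T}}(\mathbf{X}',\mathbf{Y})|_{x_i'=1-a}\Big)\Rightarrow F(\mathbf{X}',\mathbf{Y})|_{x_i'=1-a}.$$ $F|_{z=a}$ denotes $F$ with $z$ set to $a$. -}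

module Defs where

open import Data.Bool using (Bool; true; false; not; _∧_; _∨_; if_then_else_)
open import Data.Nat using (ℕ)
open import Data.Fin using (Fin; _≟_)
open import Data.Fin.Subset using (Subset; _∈_; _∉_)
open import Data.Fin.Subset.Properties using (_∈?_)
open import Data.List using (List; foldr)
open import Data.List.Base using (allFin)
open import Data.Product using (Σ; _×_)
open import Relation.Nullary using (¬_; yes; no)
open import Relation.Nullary.Decidable using (⌊_⌋)
open import Relation.Binary.PropositionalEquality using (_≡_)
open import Relation.Binary.Construct.Closure.Transitive using (TransClosure)

data Form (V : Set) : Set where
  const : Bool → Form V
  var   : V → Form V
  ¬'_   : Form V → Form V
  _∧'_  : Form V → Form V → Form V
  _∨'_  : Form V → Form V → Form V
  _⇒'_  : Form V → Form V → Form V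
  _⇔'_  : Form V → Form V → Form V

infix  9 ¬'_
infixr 7 _∧'_
infixr 6 _∨'_
infixr 5 _⇒'_
infix  4 _⇔'_

_⇒ᵇ_ : Bool → Bool → Bool
a ⇒ᵇ b = not a ∨ b

_⇔ᵇ_ : Bool → Bool → Bool
true  ⇔ᵇ b = b
false ⇔ᵇ b = not b

⟦_⟧ : ∀ {V} → Form V → (V → Bool) → Bool
⟦ const b ⟧ ρ = b
⟦ var v   ⟧ ρ = ρ v
⟦ ¬' φ    ⟧ ρ = not (⟦ φ ⟧ ρ)
⟦ φ ∧' ψ  ⟧ ρ = ⟦ φ ⟧ ρ ∧ ⟦ ψ ⟧ ρ
⟦ φ ∨' ψ  ⟧ ρ = ⟦ φ ⟧ ρ ∨ ⟦ ψ ⟧ ρ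
⟦ φ ⇒' ψ  ⟧ ρ = ⟦ φ ⟧ ρ ⇒ᵇ ⟦ ψ ⟧ ρ
⟦ φ ⇔' ψ  ⟧ ρ = ⟦ φ ⟧ ρ ⇔ᵇ ⟦ ψ ⟧ ρ

subst : ∀ {V W} → (V → Form W) → Form V → Form W
subst σ (const b) = const b
subst σ (var v)   = σ v
subst σ (¬' φ)    = ¬' subst σ φ
subst σ (φ ∧' ψ)  = subst σ φ ∧' subst σ ψ
subst σ (φ ∨' ψ)  = subst σ φ ∨' subst σ ψ
subst σ (φ ⇒' ψ)  = subst σ φ ⇒' subst σ ψ
subst σ (φ ⇔' ψ)  = subst σ φ ⇔' subst σ ψ

rename : ∀ {V W} → (V → W) → Form V → Form W
rename f = subst (λ v → var (f v))

data Occurs {V : Set} (v : V) : Form V → Set where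
  here  : Occurs v (var v)
  neg   : ∀ {φ} → Occurs v φ → Occurs v (¬' φ)
  andl  : ∀ {φ ψ} → Occurs v φ → Occurs v (φ ∧' ψ)
  andr  : ∀ {φ ψ} → Occurs v ψ → Occurs v (φ ∧' ψ)
  orl   : ∀ {φ ψ} → Occurs v φ → Occurs v (φ ∨' ψ)
  orr   : ∀ {φ ψ} → Occurs v ψ → Occurs v (φ ∨' ψ)
  impl  : ∀ {φ ψ} → Occurs v φ → Occurs v (φ ⇒' ψ)
  impr  : ∀ {φ ψ} → Occurs v ψ → Occurs v (φ ⇒' ψ)
  iffl  : ∀ {φ ψ} → Occurs v φ → Occurs v (φ ⇔' ψ)
  iffr  : ∀ {φ ψ} → Occurs v ψ → Occurs v (φ ⇔' ψ)

⋀ : ∀ {V} → List (Form V) → Form V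
⋀ = foldr _∧'_ (const true)

-- Specifications: outputs X = x_0..x_{n-1}, inputs Y = y_0..y_{m-1}

data Var (n m : ℕ) : Set where
  out : Fin n → Var n m
  inp : Fin m → Var n m

module _ {n m : ℕ} where

  env : (Fin n → Bool) → (Fin m → Bool) → Var n m → Bool
  env X Y (out j) = X j
  env X Y (inp k) = Y k

  restrict : Fin n → Bool → Form (Var n m) → Form (Var n m)
  restrict i a = subst σ
    where
    σ : Var n m → Form (Var n m)
    σ (out j) = if ⌊ j ≟ i ⌋ then const a else var (out j)
    σ (inp k) = var (inp k)

  Valid : Form (Var n m) → Set
  Valid φ = ∀ (ρ : Var n m → Bool) → ⟦ φ ⟧ ρ ≡ true

  _⪯syn_ : Form (Var n m) → Form (Var n m) → Set
  G ⪯syn F =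
    (∀ (Y : Fin m → Bool) →
       Σ (Fin n → Bool) (λ X → ⟦ F ⟧ (env X Y) ≡ true) →
       Σ (Fin n → Bool) (λ X' → ⟦ G ⟧ (env X' Y) ≡ true))
    ×
    (∀ (Y : Fin m → Bool) (X' : Fin n → Bool) →
       Σ (Fin n → Bool) (λ X → ⟦ F ⟧ (env X Y) ≡ true) →
       ⟦ G ⟧ (env X' Y) ≡ true →
       ⟦ F ⟧ (env X' Y) ≡ true)

  infix 3 _⪯syn_

  -- A system of functional definitions (T, Fun_T) in F: one f-def x_j ⇔ g_j
  -- for each x_j ∈ T (the values of g outside T are irrelevant).
  record FunDefs (F : Form (Var n m)) (T : Subset n) : Set where
    field
      g       : Fin n → Form (Var n m)
      fresh   : ∀ j → j ∈ T → ¬ Occurs (out j) (g j)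
      defines : ∀ j → j ∈ T → Valid (F ⇒' (var (out j) ⇔' g j))

  module _ {F : Form (Var n m)} {T : Subset n} (D : FunDefs F T) where
    open FunDefs D

    DependsOn : Fin n → Fin n → Set
    DependsOn j k = j ∈ T × Occurs (out k) (g j)

    Acyclic : Set
    Acyclic = ∀ j → ¬ TransClosure DependsOn j j

    FunT : Form (Var n m)
    FunT = foldr (λ j acc → if ⌊ j ∈? T ⌋ then ((var (out j) ⇔' g j) ∧' acc) else acc)
                 (const true) (allFin n)

  data Var₂ : Set where
    x  : Fin n → Var₂
    x' : Fin n → Var₂
    y  : Fin m → Var₂

  toX : Var n m → Var₂
  toX (out j) = x j
  toX (inp k) = y k

  toX' : Var n m → Var₂
  toX' (out j) = x' j
  toX' (inp k) = y k

  Valid₂ : Form Var₂ → Set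
  Valid₂ φ = ∀ (ρ : Var₂ → Bool) → ⟦ φ ⟧ ρ ≡ true

  θ : {F : Form (Var n m)} {T : Subset n} → FunDefs F T → Fin n → Bool → Form Var₂
  θ {F} {T} D i a =
    (rename toX (restrict i a F)
       ∧' (foldr (λ j acc → if (not ⌊ j ∈? T ⌋ ∧ not ⌊ j ≟ i ⌋)
                             then ((var (x j) ⇔' var (x' j)) ∧' acc) else acc)
                 (const true) (allFin n))
       ∧' rename toX' (restrict i (not a) (FunT D)))
    ⇒' rename toX' (restrict i (not a) F)

{-# OPTIONS --safe #-}
module Submission where

-- Acyclicity makes Fun_T a well-founded definition of the T-outputs in terms of
-- the other variables: two assignments that satisfy Fun_T and agree off T cannot
-- differ, since a difference at x_j forces one at a variable x_j depends on, and
-- n such steps in n variables close a dependency cycle. The same argument shows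
-- that n rounds of recomputing T by Fun_T reach a solution of Fun_T.
-- (1) follows: every model of F satisfies Fun_T, and Fun_T has one solution per Y.
-- (2): a model X of F with x_i = a is turned into the assignment that agrees with
-- X off T ∪ {x_i}, has x_i = ¬a and satisfies Fun_T; θ says exactly that this
-- assignment is again a model of F.

open import Defs
open import Data.Nat using (ℕ)
open import Data.Bool using (true; false)
open import Data.Fin.Subset using (Subset; _∈_; _∉_)
open import Data.Product using (_×_)

open import Data.Bool using (Bool; not; _∧_; _∨_; if_then_else_)
open import Data.Bool.Properties using (¬-not) renaming (_≟_ to _≟ᵇ_)
open import Data.Empty using (⊥; ⊥-elim)
open import Data.Fin using (Fin; toℕ; _≟_)
import Data.Fin as Fin
open import Data.Fin.Properties using (pigeonhole; toℕ≤pred[n])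
open import Data.Fin.Subset.Properties using (_∈?_)
open import Data.List using (List; []; _∷_; foldr; allFin)
open import Data.List.Membership.Propositional using () renaming (_∈_ to _∈ˡ_)
open import Data.List.Membership.Propositional.Properties using (∈-allFin)
open import Data.List.Relation.Unary.Any using (here; there)
open import Data.Nat using (suc; _<_; _≤_; z<s; s≤s)
open import Data.Nat.GeneralisedArithmetic using (fold)
open import Data.Nat.Properties using (n<1+n)
open import Data.Product using (Σ; ∃-syntax; _,_; proj₁; proj₂)
open import Data.Sum using (_⊎_; inj₁; inj₂; [_,_]′)
open import Data.Vec.Functional using (updateAt)
open import Data.Vec.Functional.Properties using (updateAt-updates; updateAt-minimal)
open import Function using (_∘_)
open import Relation.Binary.Construct.Closure.Transitive using (TransClosure; [_]; _∷_)
open import Relation.Binary.PropositionalEquality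
  using (_≡_; _≢_; refl; sym; trans; cong; cong₂; module ≡-Reasoning)
  renaming (subst to ≡-subst)
open import Relation.Nullary using (¬_; Dec; yes; no)
open import Relation.Nullary.Decidable using (⌊_⌋; isYes≗does; dec-true)

∧-true : ∀ {a b} → a ≡ true → b ≡ true → a ∧ b ≡ true
∧-true refl refl = refl

∧-trueˡ : ∀ {a b} → a ∧ b ≡ true → a ≡ true
∧-trueˡ {true} _ = refl

∧-trueʳ : ∀ {a b} → a ∧ b ≡ true → b ≡ true
∧-trueʳ {true} b≡true = b≡true

⇒ᵇ-mp : ∀ {a b} → a ⇒ᵇ b ≡ true → a ≡ true → b ≡ true
⇒ᵇ-mp b≡true refl = b≡true

⇔ᵇ-true⇒≡ : ∀ {a b} → a ⇔ᵇ b ≡ true → a ≡ b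
⇔ᵇ-true⇒≡ {true}  {true}  _ = refl
⇔ᵇ-true⇒≡ {false} {false} _ = refl

≡⇒⇔ᵇ-true : ∀ {a b} → a ≡ b → a ⇔ᵇ b ≡ true
≡⇒⇔ᵇ-true {true}  refl = refl
≡⇒⇔ᵇ-true {false} refl = refl

≢-cong₂⁻¹ : ∀ (op : Bool → Bool → Bool) {a a' b b'} →
  op a b ≢ op a' b' → a ≢ a' ⊎ b ≢ b'
≢-cong₂⁻¹ op {a} {a'} ne with a ≟ᵇ a'
... | yes refl = inj₂ (ne ∘ cong (op a))
... | no a≢a' = inj₁ a≢a'

if-yes : ∀ {p} {P : Set p} {A : Set} {u v : A} (d : Dec P) → P → (if ⌊ d ⌋ then u else v) ≡ u
if-yes (yes _) _ = refl
if-yes (no ¬p) p = ⊥-elim (¬p p)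

if-no : ∀ {p} {P : Set p} {A : Set} {u v : A} (d : Dec P) → ¬ P → (if ⌊ d ⌋ then u else v) ≡ v
if-no (yes p) ¬p = ⊥-elim (¬p p)
if-no (no _)  _  = refl

⟦⟧-cong : ∀ {V} (φ : Form V) {ρ ρ' : V → Bool} → (∀ v → ρ v ≡ ρ' v) → ⟦ φ ⟧ ρ ≡ ⟦ φ ⟧ ρ'
⟦⟧-cong (const b) e = refl
⟦⟧-cong (var v)   e = e v
⟦⟧-cong (¬' φ)    e = cong not (⟦⟧-cong φ e)
⟦⟧-cong (φ ∧' ψ)  e = cong₂ _∧_  (⟦⟧-cong φ e) (⟦⟧-cong ψ e)
⟦⟧-cong (φ ∨' ψ)  e = cong₂ _∨_  (⟦⟧-cong φ e) (⟦⟧-cong ψ e)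
⟦⟧-cong (φ ⇒' ψ)  e = cong₂ _⇒ᵇ_ (⟦⟧-cong φ e) (⟦⟧-cong ψ e)
⟦⟧-cong (φ ⇔' ψ)  e = cong₂ _⇔ᵇ_ (⟦⟧-cong φ e) (⟦⟧-cong ψ e)

⟦subst⟧ : ∀ {V W} (σ : V → Form W) (φ : Form V) (ρ : W → Bool) →
  ⟦ subst σ φ ⟧ ρ ≡ ⟦ φ ⟧ (λ v → ⟦ σ v ⟧ ρ)
⟦subst⟧ σ (const b) ρ = refl
⟦subst⟧ σ (var v)   ρ = refl
⟦subst⟧ σ (¬' φ)    ρ = cong not (⟦subst⟧ σ φ ρ)
⟦subst⟧ σ (φ ∧' ψ)  ρ = cong₂ _∧_  (⟦subst⟧ σ φ ρ) (⟦subst⟧ σ ψ ρ)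
⟦subst⟧ σ (φ ∨' ψ)  ρ = cong₂ _∨_  (⟦subst⟧ σ φ ρ) (⟦subst⟧ σ ψ ρ)
⟦subst⟧ σ (φ ⇒' ψ)  ρ = cong₂ _⇒ᵇ_ (⟦subst⟧ σ φ ρ) (⟦subst⟧ σ ψ ρ)
⟦subst⟧ σ (φ ⇔' ψ)  ρ = cong₂ _⇔ᵇ_ (⟦subst⟧ σ φ ρ) (⟦subst⟧ σ ψ ρ)

Disagreement : ∀ {V} → Form V → (V → Bool) → (V → Bool) → Set
Disagreement {V} φ ρ ρ' = ∃[ v ] Occurs v φ × ρ v ≢ ρ' v

disagreement-binary : ∀ {V} {φ ψ χ : Form V} {ρ ρ'} (op : Bool → Bool → Bool) →
  (∀ {v} → Occurs v φ → Occurs v χ) → (∀ {v} → Occurs v ψ → Occurs v χ) →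
  (⟦ φ ⟧ ρ ≢ ⟦ φ ⟧ ρ' → Disagreement φ ρ ρ') →
  (⟦ ψ ⟧ ρ ≢ ⟦ ψ ⟧ ρ' → Disagreement ψ ρ ρ') →
  op (⟦ φ ⟧ ρ) (⟦ ψ ⟧ ρ) ≢ op (⟦ φ ⟧ ρ') (⟦ ψ ⟧ ρ') → Disagreement χ ρ ρ'
disagreement-binary op left right onφ onψ ne =
  [ along left ∘ onφ , along right ∘ onψ ]′ (≢-cong₂⁻¹ op ne)
  where
  along : ∀ {θ χ ρ ρ'} → (∀ {v} → Occurs v θ → Occurs v χ) →
    Disagreement θ ρ ρ' → Disagreement χ ρ ρ'
  along occ (v , o , d) = v , occ o , d

⟦⟧-≢⇒disagreement : ∀ {V} (φ : Form V) ρ ρ' → ⟦ φ ⟧ ρ ≢ ⟦ φ ⟧ ρ' → Disagreement φ ρ ρ'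
⟦⟧-≢⇒disagreement (const b) ρ ρ' ne = ⊥-elim (ne refl)
⟦⟧-≢⇒disagreement (var v)   ρ ρ' ne = v , here , ne
⟦⟧-≢⇒disagreement (¬' φ)    ρ ρ' ne with ⟦⟧-≢⇒disagreement φ ρ ρ' (ne ∘ cong not)
... | v , o , d = v , neg o , d
⟦⟧-≢⇒disagreement (φ ∧' ψ) ρ ρ' =
  disagreement-binary _∧_ andl andr (⟦⟧-≢⇒disagreement φ ρ ρ') (⟦⟧-≢⇒disagreement ψ ρ ρ')
⟦⟧-≢⇒disagreement (φ ∨' ψ) ρ ρ' =
  disagreement-binary _∨_ orl orr (⟦⟧-≢⇒disagreement φ ρ ρ') (⟦⟧-≢⇒disagreement ψ ρ ρ')
⟦⟧-≢⇒disagreement (φ ⇒' ψ) ρ ρ' =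
  disagreement-binary _⇒ᵇ_ impl impr (⟦⟧-≢⇒disagreement φ ρ ρ') (⟦⟧-≢⇒disagreement ψ ρ ρ')
⟦⟧-≢⇒disagreement (φ ⇔' ψ) ρ ρ' =
  disagreement-binary _⇔ᵇ_ iffl iffr (⟦⟧-≢⇒disagreement φ ρ ρ') (⟦⟧-≢⇒disagreement ψ ρ ρ')

-- Both Fun_T and the conjunct ⋀ (x_j ⇔ x_j') of θ are of this shape.
guarded : ∀ {A V : Set} → (A → Bool) → (A → Form V) → List A → Form V
guarded c φ = foldr (λ j acc → if c j then φ j ∧' acc else acc) (const true)

guarded-intro : ∀ {A V : Set} (c : A → Bool) (φ : A → Form V) (ρ : V → Bool) →
  (∀ j → c j ≡ true → ⟦ φ j ⟧ ρ ≡ true) → ∀ l → ⟦ guarded c φ l ⟧ ρ ≡ true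
guarded-intro c φ ρ h [] = refl
guarded-intro c φ ρ h (j ∷ l) with c j in cj
... | true  = ∧-true (h j cj) (guarded-intro c φ ρ h l)
... | false = guarded-intro c φ ρ h l

guarded-elim : ∀ {A V : Set} (c : A → Bool) (φ : A → Form V) (ρ : V → Bool) l →
  ⟦ guarded c φ l ⟧ ρ ≡ true → ∀ {j} → j ∈ˡ l → c j ≡ true → ⟦ φ j ⟧ ρ ≡ true
guarded-elim c φ ρ (k ∷ l) h j∈l cj with c k in ck | j∈l
... | true  | here refl = ∧-trueˡ h
... | true  | there j∈l' = guarded-elim c φ ρ l (∧-trueʳ h) j∈l' cj
... | false | here refl with () ← trans (sym ck) cj
... | false | there j∈l' = guarded-elim c φ ρ l h j∈l' cj

-- Following the descent from j for n steps visits n + 1 vertices of Fin n, so by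
-- pigeonhole one vertex is visited twice and the path between the visits is a cycle.
acyclic⇒¬descent : ∀ {n} {R : Fin n → Fin n → Set} → (∀ j → ¬ TransClosure R j j) →
  (P : ℕ → Fin n → Set) → (∀ t j → P (suc t) j → ∃[ k ] R j k × P t k) →
  ∀ j → ¬ P n j
acyclic⇒¬descent {n} {R} acyclic P descend j p =
  revisit (pigeonhole (n<1+n n) (λ s → walk n j p (toℕ s)))
  where
  walk : ∀ t j → P t j → ℕ → Fin n
  walk t       j p ℕ.zero  = j
  walk ℕ.zero  j p (suc s) = j
  walk (suc t) j p (suc s) with k , _ , q ← descend t j p = walk t k q s

  path : ∀ t j (p : P t j) s r → s < r → r ≤ t →
    TransClosure R (walk t j p s) (walk t j p r)
  path (suc t) j p ℕ.zero (suc ℕ.zero) _ _ with descend t j p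
  ... | k , jRk , q = [ jRk ]
  path (suc t) j p ℕ.zero (suc (suc r)) _ (s≤s r≤t) with descend t j p
  ... | k , jRk , q = jRk ∷ path t k q ℕ.zero (suc r) z<s r≤t
  path (suc t) j p (suc s) (suc r) (s≤s s<r) (s≤s r≤t) with descend t j p
  ... | k , jRk , q = path t k q s r s<r r≤t

  revisit : (∃[ a ] ∃[ b ] a Fin.< b × walk n j p (toℕ a) ≡ walk n j p (toℕ b)) → ⊥
  revisit (a , b , a<b , same) =
    acyclic _ (≡-subst (λ v → TransClosure R v _) same
                       (path n j p (toℕ a) (toℕ b) a<b (toℕ≤pred[n] b)))

module _ {n m : ℕ} where

  env-cong : ∀ {X X' : Fin n → Bool} (Y : Fin m → Bool) →
    (∀ j → X j ≡ X' j) → ∀ v → env X Y v ≡ env X' Y v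
  env-cong Y X≗X' (out j) = X≗X' j
  env-cong Y X≗X' (inp k) = refl

  ⟦restrict⟧ : ∀ i a (φ : Form (Var n m)) (ρ : Var n m → Bool) →
    ρ (out i) ≡ a → ⟦ restrict i a φ ⟧ ρ ≡ ⟦ φ ⟧ ρ
  ⟦restrict⟧ i a φ ρ ρi≡a = trans (⟦subst⟧ _ φ ρ) (⟦⟧-cong φ agree)
    where
    agree : ∀ v → ⟦ restrict i a (var v) ⟧ ρ ≡ ρ v
    agree (out j) with j ≟ i
    ... | yes refl = sym ρi≡a
    ... | no _ = refl
    agree (inp k) = refl

  literal : Bool → Fin n → Form (Var n m)
  literal true  i = var (out i)
  literal false i = ¬' var (out i)

  literal-intro : ∀ b i (ρ : Var n m → Bool) → ρ (out i) ≡ b → ⟦ literal b i ⟧ ρ ≡ true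
  literal-intro true  i ρ ρi≡b = ρi≡b
  literal-intro false i ρ ρi≡b = cong not ρi≡b

  literal-elim : ∀ b i (ρ : Var n m → Bool) → ⟦ literal b i ⟧ ρ ≡ true → ρ (out i) ≡ b
  literal-elim true  i ρ h = h
  literal-elim false i ρ h with ρ (out i)
  ... | false = refl

  env₂ : (Fin n → Bool) → (Fin n → Bool) → (Fin m → Bool) → Var₂ {n} {m} → Bool
  env₂ X X' Y (x j)  = X j
  env₂ X X' Y (x' j) = X' j
  env₂ X X' Y (y k)  = Y k

  ⟦rename-toX⟧ : ∀ φ X X' Y → ⟦ rename toX φ ⟧ (env₂ X X' Y) ≡ ⟦ φ ⟧ (env X Y)
  ⟦rename-toX⟧ φ X X' Y = trans (⟦subst⟧ _ φ (env₂ X X' Y)) (⟦⟧-cong φ pointwise)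
    where
    pointwise : ∀ v → env₂ X X' Y (toX v) ≡ env X Y v
    pointwise (out j) = refl
    pointwise (inp k) = refl

  ⟦rename-toX'⟧ : ∀ φ X X' Y → ⟦ rename toX' φ ⟧ (env₂ X X' Y) ≡ ⟦ φ ⟧ (env X' Y)
  ⟦rename-toX'⟧ φ X X' Y = trans (⟦subst⟧ _ φ (env₂ X X' Y)) (⟦⟧-cong φ pointwise)
    where
    pointwise : ∀ v → env₂ X X' Y (toX' v) ≡ env X' Y v
    pointwise (out j) = refl
    pointwise (inp k) = refl

  module _ {F : Form (Var n m)} {T : Subset n} (D : FunDefs F T) where
    open FunDefs D

    Solves : (Fin m → Bool) → (Fin n → Bool) → Set
    Solves Y X = ∀ j → j ∈ T → X j ≡ ⟦ g j ⟧ (env X Y)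

    AgreeOffT : (Fin n → Bool) → (Fin n → Bool) → Set
    AgreeOffT X X' = ∀ j → j ∉ T → X j ≡ X' j

    model⇒solves : ∀ X Y → ⟦ F ⟧ (env X Y) ≡ true → Solves Y X
    model⇒solves X Y hF j j∈T = ⇔ᵇ-true⇒≡ (⇒ᵇ-mp (defines j j∈T (env X Y)) hF)

    FunT⇒solves : ∀ X Y → ⟦ FunT D ⟧ (env X Y) ≡ true → Solves Y X
    FunT⇒solves X Y h j j∈T =
      ⇔ᵇ-true⇒≡ (guarded-elim _ _ (env X Y) (allFin n) h (∈-allFin j)
                   (trans (isYes≗does (j ∈? T)) (dec-true (j ∈? T) j∈T)))

    solves⇒FunT : ∀ X Y → Solves Y X → ⟦ FunT D ⟧ (env X Y) ≡ true
    solves⇒FunT X Y solves = guarded-intro _ _ (env X Y) defined (allFin n)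
      where
      defined : ∀ j → ⌊ j ∈? T ⌋ ≡ true → ⟦ var (out j) ⇔' g j ⟧ (env X Y) ≡ true
      defined j c with j ∈? T
      ... | yes j∈T = ≡⇒⇔ᵇ-true (solves j j∈T)

    disagreement-descends : ∀ Y {A A' B B' : Fin n → Bool} → AgreeOffT A B →
      (∀ j → j ∈ T → A j ≡ ⟦ g j ⟧ (env A' Y)) →
      (∀ j → j ∈ T → B j ≡ ⟦ g j ⟧ (env B' Y)) →
      ∀ j → A j ≢ B j → ∃[ k ] DependsOn D j k × A' k ≢ B' k
    disagreement-descends Y A≡B A-def B-def j A≢B with j ∈? T
    ... | no j∉T = ⊥-elim (A≢B (A≡B j j∉T))
    ... | yes j∈T
      with ⟦⟧-≢⇒disagreement (g j) _ _ (λ e → A≢B (trans (A-def j j∈T) (trans e (sym (B-def j j∈T)))))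
    ...   | out k , occ , d = k , (j∈T , occ) , d
    ...   | inp k , _   , d = ⊥-elim (d refl)

    module _ (acyclic : Acyclic D) where

      solution-unique : ∀ Y {A B} → Solves Y A → Solves Y B → AgreeOffT A B → ∀ j → A j ≡ B j
      solution-unique Y {A} {B} solvesA solvesB A≡B j with A j ≟ᵇ B j
      ... | yes e = e
      ... | no ne = ⊥-elim (acyclic⇒¬descent acyclic (λ _ k → A k ≢ B k)
                              (λ _ → disagreement-descends Y A≡B solvesA solvesB) j ne)

      solution-exists : ∀ Y (b : Fin n → Bool) → ∃[ Z ] Solves Y Z × AgreeOffT Z b
      solution-exists Y b = Z , (λ j j∈T → trans (fixed j) (if-yes (j ∈? T) j∈T))
                              , (λ j j∉T → trans (fixed j) (if-no (j ∈? T) j∉T))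
        where
        recompute : (Fin n → Bool) → Fin n → Bool
        recompute A j = if ⌊ j ∈? T ⌋ then ⟦ g j ⟧ (env A Y) else b j

        rounds : ℕ → Fin n → Bool
        rounds = fold b recompute

        Z : Fin n → Bool
        Z = rounds n

        Unstable : ℕ → Fin n → Set
        Unstable t j = rounds t j ≢ rounds (suc t) j

        unstable-descends : ∀ t j → Unstable (suc t) j → ∃[ k ] DependsOn D j k × Unstable t k
        unstable-descends t = disagreement-descends Y
          (λ j j∉T → trans (if-no (j ∈? T) j∉T) (sym (if-no (j ∈? T) j∉T)))
          (λ j j∈T → if-yes (j ∈? T) j∈T)
          (λ j j∈T → if-yes (j ∈? T) j∈T)

        fixed : ∀ j → Z j ≡ recompute Z j
        fixed j with Z j ≟ᵇ recompute Z j
        ... | yes e = e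
        ... | no ne = ⊥-elim (acyclic⇒¬descent acyclic Unstable unstable-descends j ne)

      FunT-⪯syn : (∀ j → j ∈ T) → FunT D ⪯syn F
      FunT-⪯syn total = exists , sound
        where
        exists : ∀ Y → Σ (Fin n → Bool) (λ X → ⟦ F ⟧ (env X Y) ≡ true) →
          Σ (Fin n → Bool) (λ X' → ⟦ FunT D ⟧ (env X' Y) ≡ true)
        exists Y (X , hF) = X , solves⇒FunT X Y (model⇒solves X Y hF)

        sound : ∀ Y X' → Σ (Fin n → Bool) (λ X → ⟦ F ⟧ (env X Y) ≡ true) →
          ⟦ FunT D ⟧ (env X' Y) ≡ true → ⟦ F ⟧ (env X' Y) ≡ true
        sound Y X' (X , hF) hFunT = trans (sym (⟦⟧-cong F (env-cong Y X≗X'))) hF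
          where
          X≗X' : ∀ j → X j ≡ X' j
          X≗X' = solution-unique Y (model⇒solves X Y hF) (FunT⇒solves X' Y hFunT)
                   (λ j j∉T → ⊥-elim (j∉T (total j)))

      literal-⪯syn : ∀ i → i ∉ T → ∀ a →
        Valid₂ (θ D i a) → (literal (not a) i ∧' restrict i (not a) F) ⪯syn F
      literal-⪯syn i i∉T a valid = exists , sound
        where
        sound : ∀ Y X' → Σ (Fin n → Bool) (λ X → ⟦ F ⟧ (env X Y) ≡ true) →
          ⟦ literal (not a) i ∧' restrict i (not a) F ⟧ (env X' Y) ≡ true →
          ⟦ F ⟧ (env X' Y) ≡ true
        sound Y X' _ h = trans (sym (⟦restrict⟧ i (not a) F (env X' Y)
                                      (literal-elim (not a) i (env X' Y) (∧-trueˡ h))))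
                               (∧-trueʳ h)

        flipped-model : ∀ Y X → ⟦ F ⟧ (env X Y) ≡ true → X i ≡ a →
          ∃[ Z ] Z i ≡ not a × ⟦ restrict i (not a) F ⟧ (env Z Y) ≡ true
        flipped-model Y X hF Xi≡a = Z , Zi≡¬a , flipped
          where
          open ≡-Reasoning
          b : Fin n → Bool
          b = updateAt X i (λ _ → not a)

          Z : Fin n → Bool
          Z = proj₁ (solution-exists Y b)

          Z-solves : Solves Y Z
          Z-solves = proj₁ (proj₂ (solution-exists Y b))

          Z≡b : AgreeOffT Z b
          Z≡b = proj₂ (proj₂ (solution-exists Y b))

          Zi≡¬a : Z i ≡ not a
          Zi≡¬a = trans (Z≡b i i∉T) (updateAt-updates i X)

          copies : ∀ j → not ⌊ j ∈? T ⌋ ∧ not ⌊ j ≟ i ⌋ ≡ true →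
            ⟦ var (x j) ⇔' var (x' j) ⟧ (env₂ X Z Y) ≡ true
          copies j c with j ∈? T | j ≟ i
          ... | no j∉T | no j≢i =
            ≡⇒⇔ᵇ-true (sym (trans (Z≡b j j∉T) (updateAt-minimal j i X j≢i)))

          F-at-X : ⟦ rename toX (restrict i a F) ⟧ (env₂ X Z Y) ≡ true
          F-at-X = begin
            ⟦ rename toX (restrict i a F) ⟧ (env₂ X Z Y) ≡⟨ ⟦rename-toX⟧ (restrict i a F) X Z Y ⟩
            ⟦ restrict i a F ⟧ (env X Y)                 ≡⟨ ⟦restrict⟧ i a F (env X Y) Xi≡a ⟩
            ⟦ F ⟧ (env X Y)                              ≡⟨ hF ⟩
            true                                         ∎

          Z-FunT : ⟦ rename toX' (restrict i (not a) (FunT D)) ⟧ (env₂ X Z Y) ≡ true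
          Z-FunT = begin
            ⟦ rename toX' (restrict i (not a) (FunT D)) ⟧ (env₂ X Z Y)
              ≡⟨ ⟦rename-toX'⟧ (restrict i (not a) (FunT D)) X Z Y ⟩
            ⟦ restrict i (not a) (FunT D) ⟧ (env Z Y)
              ≡⟨ ⟦restrict⟧ i (not a) (FunT D) (env Z Y) Zi≡¬a ⟩
            ⟦ FunT D ⟧ (env Z Y)
              ≡⟨ solves⇒FunT Z Y Z-solves ⟩
            true ∎

          flipped : ⟦ restrict i (not a) F ⟧ (env Z Y) ≡ true
          flipped = trans (sym (⟦rename-toX'⟧ (restrict i (not a) F) X Z Y))
            (⇒ᵇ-mp (valid (env₂ X Z Y))
              (∧-true F-at-X (∧-true (guarded-intro _ _ (env₂ X Z Y) copies (allFin n)) Z-FunT)))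

        exists : ∀ Y → Σ (Fin n → Bool) (λ X → ⟦ F ⟧ (env X Y) ≡ true) →
          Σ (Fin n → Bool) (λ X' → ⟦ literal (not a) i ∧' restrict i (not a) F ⟧ (env X' Y) ≡ true)
        exists Y (X , hF) with X i ≟ᵇ a
        ... | yes Xi≡a with Z , Zi≡¬a , hZ ← flipped-model Y X hF Xi≡a =
          Z , ∧-true (literal-intro (not a) i (env Z Y) Zi≡¬a) hZ
        ... | no Xi≢a = X , ∧-true (literal-intro (not a) i (env X Y) Xi≡¬a)
                                   (trans (⟦restrict⟧ i (not a) F (env X Y) Xi≡¬a) hF)
          where
          Xi≡¬a : X i ≡ not a
          Xi≡¬a = ¬-not Xi≢a

lemma6 : ∀ {n m : ℕ} (F : Form (Var n m)) (T : Subset n) (D : FunDefs F T) →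
    Acyclic D →
    ((∀ j → j ∈ T) → FunT D ⪯syn F)
    ×
    (∀ i → i ∉ T →
      (Valid₂ (θ D i false) → (var (out i) ∧' restrict i true F) ⪯syn F)
      ×
      (Valid₂ (θ D i true) → (¬' var (out i) ∧' restrict i false F) ⪯syn F))
lemma6 F T D acyclic =
  FunT-⪯syn D acyclic ,
  λ i i∉T → literal-⪯syn D acyclic i i∉T false , literal-⪯syn D acyclic i i∉T true
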